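{- In any layer $L_i$ of $A_n$, the difference of the lengths (numbers of elements) of any two consecutive nonempty rows is $1$ or $2$.
   Context: For $n\ge1$ and $A_n=(a_1,\dots,a_n)$, for each $i\le n$ divisible by neither 2 nor 3 the layer $L_i$ is $\{a_{i2^k3^s}:k,s\ge0,\ i2^k3^s\le n\}$, with $a_{i2^k3^s}$ placed in row $s$, column $k$. Row $s$ consists of the elements $a_{i3^s2^k}$ with $i3^s2^k\le n$; its length is its number of elements. Consecutive rows are rows $s$ and $s+1$. -}

module Defs where

open import Data.Nat using (ℕ; suc; _*_; _^_; _≤?_)
open import Data.List using (List; length; filter; upTo)

-- Positions in A_n are 1..n; the entry a_j sits at index j.
-- Row s of layer L_i consists of the positions i * 3^s * 2^k ≤ n (k ≥ 0);
-- its length is the number of such k.  For i ≥ 1, i * 3^s * 2^k ≤ n forces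
-- 2^k ≤ n, hence k < n + 1, so enumerating k ∈ {0,…,n} counts all of them.
rowLength : (n i s : ℕ) → ℕ
rowLength n i s = length (filter (λ k → i * 3 ^ s * 2 ^ k ≤? n) (upTo (suc n)))

{-# OPTIONS --safe #-}
-- Row s of the layer L_i consists of the k with i·3^s·2^k ≤ n; these form an
-- initial segment {0, …, c_s − 1} of ℕ, so the row length is the cutoff c_s.
-- Since 2 < 3 < 4, i·3^(s+1)·2^k ≤ n implies i·3^s·2^(k+1) ≤ n, and
-- i·3^s·2^(k+2) ≤ n implies i·3^(s+1)·2^k ≤ n.  Hence, as soon as row s+1 is
-- nonempty, c_(s+1) + 1 ≤ c_s ≤ c_(s+1) + 2.
module Submission where

open import Defs
open import Data.Nat using (ℕ; suc; _≤_; ∣_-_∣)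
open import Data.Nat.Divisibility using (_∣_)
open import Data.Sum using (_⊎_)
open import Relation.Nullary using (¬_)
open import Relation.Binary.PropositionalEquality using (_≡_)

open import Data.Nat using (zero; _+_; _*_; _^_; _⊓_; _<_; _≤?_; z≤n; s≤s; z<s)
open import Data.Nat.Properties
open import Data.List using (length; filter; upTo; [_]; _++_)
open import Data.List.Properties using (upTo-∷ʳ; filter-++; length-++; filter-accept; filter-reject)
open import Data.Product using (∃-syntax; _,_; proj₁; proj₂)
open import Data.Sum using (inj₁; inj₂)
open import Data.Empty using (⊥-elim)
open import Function using (_∘_; _⇔_; mk⇔; Equivalence)
open import Level using (0ℓ)
open import Relation.Nullary using (yes; no)
open import Relation.Unary using (Pred; Decidable; _⊆′_)
open import Relation.Binary.PropositionalEquality using (refl; sym; trans; cong; subst; module ≡-Reasoning)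

open Equivalence using (to; from)

_HoldsExactlyBelow_ : ∀ {p} → Pred ℕ p → ℕ → Set p
P HoldsExactlyBelow c = ∀ k → P k ⇔ k < c

DownwardClosed : ∀ {p} → Pred ℕ p → Set p
DownwardClosed P = ∀ {j k} → j ≤ k → P k → P j

module _ {p} {P : Pred ℕ p} where

  holdsExactlyBelow⇒≤ : ∀ {c N} → P HoldsExactlyBelow c → ¬ P N → c ≤ N
  holdsExactlyBelow⇒≤ P⇔<c ¬PN = ≮⇒≥ (¬PN ∘ from (P⇔<c _))

  module _ (P? : Decidable P) where

    holdsExactlyBelow-exists : DownwardClosed P → ∀ N → ¬ P N → ∃[ c ] P HoldsExactlyBelow c
    holdsExactlyBelow-exists closed zero ¬P0 =
      0 , λ k → mk⇔ (λ Pk → ⊥-elim (¬P0 (closed z≤n Pk))) λ ()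
    holdsExactlyBelow-exists closed (suc N) ¬P1+N with P? N
    ... | yes PN = suc N , λ k → mk⇔
            (λ Pk → s≤s (≮⇒≥ (λ N<k → ¬P1+N (closed N<k Pk))))
            (λ k<1+N → closed (≤-pred k<1+N) PN)
    ... | no ¬PN = holdsExactlyBelow-exists closed N ¬PN

    length-filter-upTo : ∀ {c} → P HoldsExactlyBelow c → ∀ N → length (filter P? (upTo N)) ≡ N ⊓ c
    length-filter-upTo P⇔<c zero = refl
    length-filter-upTo {c} P⇔<c (suc N) = begin
      length (filter P? (upTo (suc N)))                         ≡⟨ cong (length ∘ filter P?) (upTo-∷ʳ N) ⟨
      length (filter P? (upTo N ++ [ N ]))                      ≡⟨ cong length (filter-++ P? (upTo N) [ N ]) ⟩
      length (filter P? (upTo N) ++ filter P? [ N ])            ≡⟨ length-++ (filter P? (upTo N)) ⟩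
      length (filter P? (upTo N)) + length (filter P? [ N ])    ≡⟨ cong (_+ _) (length-filter-upTo P⇔<c N) ⟩
      N ⊓ c + length (filter P? [ N ])                          ≡⟨ last-position ⟩
      suc N ⊓ c                                                 ∎
      where
      open ≡-Reasoning
      last-position : N ⊓ c + length (filter P? [ N ]) ≡ suc N ⊓ c
      last-position with N <? c
      ... | yes N<c = begin
        N ⊓ c + length (filter P? [ N ]) ≡⟨ cong (λ xs → N ⊓ c + length xs) (filter-accept P? (from (P⇔<c N) N<c)) ⟩
        N ⊓ c + 1                        ≡⟨ cong (_+ 1) (m≤n⇒m⊓n≡m (<⇒≤ N<c)) ⟩
        N + 1                            ≡⟨ +-comm N 1 ⟩
        suc N                            ≡⟨ m≤n⇒m⊓n≡m N<c ⟨
        suc N ⊓ c                        ∎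
      ... | no N≮c = begin
        N ⊓ c + length (filter P? [ N ]) ≡⟨ cong (λ xs → N ⊓ c + length xs) (filter-reject P? (N≮c ∘ to (P⇔<c N))) ⟩
        N ⊓ c + 0                        ≡⟨ +-identityʳ (N ⊓ c) ⟩
        N ⊓ c                            ≡⟨ m≥n⇒m⊓n≡n (≮⇒≥ N≮c) ⟩
        c                                ≡⟨ m≥n⇒m⊓n≡n (≤-trans (≮⇒≥ N≮c) (n≤1+n N)) ⟨
        suc N ⊓ c                        ∎

module _ {p q} {P : Pred ℕ p} {Q : Pred ℕ q} (j : ℕ) where

  holdsExactlyBelow-+-≤ : ∀ {a b} → P HoldsExactlyBelow a → Q HoldsExactlyBelow b →
                          Q ⊆′ P ∘ (j +_) → 1 ≤ b → j + b ≤ a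
  holdsExactlyBelow-+-≤ {a} {suc d} P⇔<a Q⇔<b Q⇒P _ =
    subst (_≤ a) (sym (+-suc j d)) (to (P⇔<a (j + d)) (Q⇒P d (from (Q⇔<b d) ≤-refl)))

  holdsExactlyBelow-≤-+ : ∀ {a b} → P HoldsExactlyBelow a → Q HoldsExactlyBelow b →
                          P ∘ (j +_) ⊆′ Q → a ≤ j + b
  holdsExactlyBelow-≤-+ {b = b} P⇔<a Q⇔<b P⇒Q =
    ≮⇒≥ (λ j+b<a → <-irrefl refl (to (Q⇔<b b) (P⇒Q b (from (P⇔<a (j + b)) j+b<a))))

n<2^n : ∀ n → n < 2 ^ n
n<2^n zero = z<s
n<2^n (suc n) = begin-strict
  suc n           ≤⟨ n<2^n n ⟩
  2 ^ n           <⟨ m<m+n (2 ^ n) (m^n>0 2 n) ⟩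
  2 ^ n + 2 ^ n   ≡⟨ cong (2 ^ n +_) (+-identityʳ (2 ^ n)) ⟨
  2 ^ suc n       ∎
  where open ≤-Reasoning

Doubling≤ : ℕ → ℕ → Pred ℕ 0ℓ
Doubling≤ n m k = m * 2 ^ k ≤ n

doubling≤? : ∀ n m → Decidable (Doubling≤ n m)
doubling≤? n m k = m * 2 ^ k ≤? n

chainLength : ℕ → ℕ → ℕ
chainLength n m = length (filter (doubling≤? n m) (upTo (suc n)))

doubling≤-downwardClosed : ∀ {n m} → DownwardClosed (Doubling≤ n m)
doubling≤-downwardClosed {m = m} j≤k = ≤-trans (*-monoʳ-≤ m (^-monoʳ-≤ 2 j≤k))

¬doubling≤-at-n : ∀ {n m} → 1 ≤ m → ¬ Doubling≤ n m n
¬doubling≤-at-n {n} {m} 1≤m m2ⁿ≤n = <⇒≱ (begin-strict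
  n          <⟨ n<2^n n ⟩
  2 ^ n      ≡⟨ *-identityˡ (2 ^ n) ⟨
  1 * 2 ^ n  ≤⟨ *-monoˡ-≤ (2 ^ n) 1≤m ⟩
  m * 2 ^ n  ∎) m2ⁿ≤n
  where open ≤-Reasoning

doubling≤-holdsExactlyBelow-chainLength : ∀ {n m} → 1 ≤ m → Doubling≤ n m HoldsExactlyBelow chainLength n m
doubling≤-holdsExactlyBelow-chainLength {n} {m} 1≤m =
  subst (Doubling≤ n m HoldsExactlyBelow_) (sym chainLength≡c) doubling⇔<c
  where
  cutoff : ∃[ c ] Doubling≤ n m HoldsExactlyBelow c
  cutoff = holdsExactlyBelow-exists (doubling≤? n m) (doubling≤-downwardClosed {n} {m}) n (¬doubling≤-at-n 1≤m)
  c : ℕ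
  c = proj₁ cutoff
  doubling⇔<c : Doubling≤ n m HoldsExactlyBelow c
  doubling⇔<c = proj₂ cutoff
  chainLength≡c : chainLength n m ≡ c
  chainLength≡c = trans (length-filter-upTo (doubling≤? n m) doubling⇔<c (suc n))
                        (m≥n⇒m⊓n≡n (≤-trans (holdsExactlyBelow⇒≤ doubling⇔<c (¬doubling≤-at-n 1≤m)) (n≤1+n n)))

*2^-+ : ∀ m j k → m * 2 ^ (j + k) ≡ m * 2 ^ j * 2 ^ k
*2^-+ m j k = trans (cong (m *_) (^-distribˡ-+-* 2 j k)) (sym (*-assoc m (2 ^ j) (2 ^ k)))

doubling≤-shiftʳ : ∀ {n m m′} j → m * 2 ^ j ≤ m′ → Doubling≤ n m′ ⊆′ Doubling≤ n m ∘ (j +_)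
doubling≤-shiftʳ {n} {m} j m2ʲ≤m′ k m′2ᵏ≤n =
  subst (_≤ n) (sym (*2^-+ m j k)) (≤-trans (*-monoˡ-≤ (2 ^ k) m2ʲ≤m′) m′2ᵏ≤n)

doubling≤-shiftˡ : ∀ {n m m′} j → m′ ≤ m * 2 ^ j → Doubling≤ n m ∘ (j +_) ⊆′ Doubling≤ n m′
doubling≤-shiftˡ {n} {m} j m′≤m2ʲ k m2ʲ⁺ᵏ≤n =
  ≤-trans (*-monoˡ-≤ (2 ^ k) m′≤m2ʲ) (subst (_≤ n) (*2^-+ m j k) m2ʲ⁺ᵏ≤n)

n<m≤2+n⇒∣m-n∣≡1⊎2 : ∀ {m n} → n < m → m ≤ 2 + n → ∣ m - n ∣ ≡ 1 ⊎ ∣ m - n ∣ ≡ 2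
n<m≤2+n⇒∣m-n∣≡1⊎2 {1} {zero} _ _ = inj₁ refl
n<m≤2+n⇒∣m-n∣≡1⊎2 {2} {zero} _ _ = inj₂ refl
n<m≤2+n⇒∣m-n∣≡1⊎2 {suc (suc (suc _))} {zero} _ (s≤s (s≤s ()))
n<m≤2+n⇒∣m-n∣≡1⊎2 {suc m} {suc n} (s≤s n<m) (s≤s m≤2+n) = n<m≤2+n⇒∣m-n∣≡1⊎2 n<m m≤2+n

lemmaA1 : (n i s : ℕ) → 1 ≤ i → i ≤ n → ¬ (2 ∣ i) → ¬ (3 ∣ i)
          → 1 ≤ rowLength n i s → 1 ≤ rowLength n i (suc s)
          → ∣ rowLength n i s - rowLength n i (suc s) ∣ ≡ 1 ⊎ ∣ rowLength n i s - rowLength n i (suc s) ∣ ≡ 2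
lemmaA1 n i s 1≤i _ _ _ _ 1≤row₊ =
  n<m≤2+n⇒∣m-n∣≡1⊎2 (holdsExactlyBelow-+-≤ 1 row row₊ (doubling≤-shiftʳ {m = m} 1 m*2≤m₊) 1≤row₊)
                    (holdsExactlyBelow-≤-+ 2 row row₊ (doubling≤-shiftˡ {m = m} 2 m₊≤m*4))
  where
  m m₊ : ℕ
  m = i * 3 ^ s
  m₊ = i * 3 ^ suc s
  m₊≡m*3 : m₊ ≡ m * 3
  m₊≡m*3 = trans (cong (i *_) (*-comm 3 (3 ^ s))) (sym (*-assoc i (3 ^ s) 3))
  m*2≤m₊ : m * 2 ≤ m₊
  m*2≤m₊ = subst (m * 2 ≤_) (sym m₊≡m*3) (*-monoʳ-≤ m (n≤1+n 2))
  m₊≤m*4 : m₊ ≤ m * 4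
  m₊≤m*4 = subst (_≤ m * 4) (sym m₊≡m*3) (*-monoʳ-≤ m (n≤1+n 3))
  row : Doubling≤ n m HoldsExactlyBelow rowLength n i s
  row = doubling≤-holdsExactlyBelow-chainLength (*-mono-≤ 1≤i (m^n>0 3 s))
  row₊ : Doubling≤ n m₊ HoldsExactlyBelow rowLength n i (suc s)
  row₊ = doubling≤-holdsExactlyBelow-chainLength (*-mono-≤ 1≤i (m^n>0 3 (suc s)))
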